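{- There exist an absolute constant $C>0$ and a function $f:\mathbb{N}\to\mathbb{R}$ with $f(n)\to\infty$ as $n\to\infty$ such that for every positive integer $n$ and every $n$-vertex tournament $G$, if $\pi$ is a uniformly random linear ordering of the vertex set of $G$, then $\Pr\left(\alpha(G_\pi)\le C\sqrt n\right)\ge 1-n^{ -f(n)}$.
   Context: A tournament is an orientation of a complete graph. For an oriented graph $G$ and a linear ordering $\pi$ of $V(G)$, $G_\pi$ is the subgraph of $G$ on the same vertex set consisting of the edges oriented forwards according to $\pi$. $\alpha$ denotes the independence number of the underlying undirected graph. -}

module Defs where

open import Data.Nat using (ℕ; _≤_; _<_; _*_)
open import Relation.Nullary using (¬_)
open import Data.Bool using (Bool; true; false; not)
open import Data.Fin using (Fin) renaming (_<_ to _<ᶠ_)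
open import Data.Fin.Subset using (Subset; _∈_; ∣_∣)
open import Data.Vec using (Vec; lookup; toList)
open import Data.List.Relation.Unary.Unique.Propositional using (Unique)
open import Data.Product using (Σ; ∃; ∃-syntax; _×_)
open import Relation.Binary.PropositionalEquality using (_≡_; _≢_)

record Tournament (n : ℕ) : Set where
  field
    beats   : Fin n → Fin n → Bool
    irrefl  : ∀ u → beats u u ≡ false
    orient  : ∀ u w → u ≢ w → beats u w ≡ not (beats w u)
open Tournament public

-- A linear ordering π of Fin n, represented by its rank vector:
-- lookup r u is the position of vertex u.  It is a linear ordering iff
-- the ranks are pairwise distinct (hence a bijection Fin n → Fin n).
IsOrdering : ∀ {n} → Vec (Fin n) n → Set
IsOrdering r = Unique (toList r)

-- Edge u → w of G_π: an edge of G oriented forwards according to π.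
ForwardEdge : ∀ {n} → Tournament n → Vec (Fin n) n → Fin n → Fin n → Set
ForwardEdge G r u w = (beats G u w ≡ true) × (lookup r u <ᶠ lookup r w)

Independent : ∀ {n} → Tournament n → Vec (Fin n) n → Subset n → Set
Independent G r S = ∀ u w → u ∈ S → w ∈ S → ¬ ForwardEdge G r u w

-- α(G_π) > C √n, i.e. there is an independent set S with |S| > C √n,
-- equivalently |S|² > C² n.
AlphaExceeds : ∀ {n} → Tournament n → Vec (Fin n) n → ℕ → Set
AlphaExceeds {n} G r C = ∃[ S ] (Independent G r S × (C * C * n < ∣ S ∣ * ∣ S ∣))

TendsToInfinity : (ℕ → ℕ) → Set
TendsToInfinity f = ∀ M → ∃[ N ] (∀ n → N ≤ n → M ≤ f n)

-- If a k-set T is independent in G_π then every edge of G inside T points backwards in π, so the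
-- restriction of π to T is forced; hence at most n!/k! orderings make T independent.  This is proved
-- for injective partial rankings by induction on the number of ranks: the vertex of top rank either
-- lies outside T or is the unique vertex of T beating all others in T.  A union bound over the
-- (n choose k) sets T bounds the orderings with α(G_π) ≥ k by (n choose k) n!/k! ≤ n^k n!/(k!)².
-- Taking j = ⌊log₄ n⌋ and k = 16·2^j, so that k ≤ 16√n, 64n ≤ k² and j(j+1) ≤ k, the bound
-- k^k ≤ 4^k k! gives n^(j+k) ≤ (k!)², i.e. at most n!/n^j orderings have α(G_π) > 16√n.

module Submission where

open import Defs
open import Data.Nat using (ℕ; _≤_; _<_; _*_; _^_; _!)
open import Data.Fin using (Fin)
open import Data.Vec using (Vec)
open import Data.List using (List; length)
open import Data.List.Relation.Unary.All using (All)
open import Data.List.Relation.Unary.Unique.Propositional using (Unique)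
open import Data.Product using (∃-syntax; _×_)

open import Data.Bool using (true; false; not)
import Data.Bool as Bool
open import Data.Empty using (⊥-elim)
open import Data.Fin using (zero; suc; toℕ) renaming (_≟_ to _≟ᶠ_)
import Data.Fin as Fin
open import Data.Fin.Properties using (toℕ-injective; toℕ<n; all?) renaming (_<?_ to _<ᶠ?_)
open import Data.Fin.Subset using (Subset; ∣_∣) renaming (_∈_ to _∈ₛ_; _⊆_ to _⊆ₛ_)
open import Data.Fin.Subset.Properties using (drop-there) renaming (_∈?_ to _∈ₛ?_)
open import Data.List using ([]; _∷_; map; filter; _++_; allFin; tabulate)
open import Data.List.Properties
  using (filter-all; filter-accept; filter-reject; filter-≐; ∷-injective; ∷-injectiveˡ; ∷-injectiveʳ;
         map-++; map-∘; map-id; map-tabulate; length-map; length-++; length-tabulate)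
open import Data.List.Membership.Propositional using (_∈_; _∉_; find; lose)
open import Data.List.Membership.Propositional.Properties
  using (∈-filter⁻; ∈-filter⁺; ∈-map⁺; ∈-map⁻; ∈-++⁺ˡ; ∈-++⁺ʳ; ∈-++⁻; ∈-allFin)
import Data.List.Membership.DecPropositional as DecMembership
open import Data.List.Relation.Binary.Permutation.Propositional using (_↭_; prep; swap; ↭-refl; ↭-trans; ↭-reflexive)
open import Data.List.Relation.Binary.Permutation.Propositional.Properties using (↭-length; filter-↭)
import Data.List.Relation.Binary.Sublist.Propositional.Properties as Sublist
open import Data.List.Relation.Binary.Sublist.Propositional using () renaming (_⊆_ to _⊑_)
open import Data.List.Relation.Unary.All using ([]; _∷_)
import Data.List.Relation.Unary.All as All
open import Data.List.Relation.Unary.All.Properties using (All¬⇒¬Any; ¬All⇒Any¬)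
import Data.List.Relation.Unary.All.Properties as All
open import Data.List.Relation.Unary.AllPairs using ([]; _∷_)
open import Data.List.Relation.Unary.Any using (Any; here; there)
import Data.List.Relation.Unary.Unique.Propositional.Properties as Unique
open import Data.Nat using (zero; suc; pred; _+_; z≤n; s≤s; s≤s⁻¹) renaming (_≟_ to _≟ℕ_)
open import Data.Nat.Combinatorics using (_C_; nCk+nC[k+1]≡[n+1]C[k+1])
open import Data.Nat.ListAction using (sum)
open import Data.Nat.ListAction.Properties using (sum-++)
open import Data.Nat.Properties
open import Algebra.Properties.CommutativeSemigroup *-commutativeSemigroup using (interchange; x∙yz≈y∙xz; xy∙z≈xz∙y)
open import Data.Nat.Tactic.RingSolver using (solve-∀)
open import Data.Product using (_,_; proj₁; proj₂)
open import Data.Product.Properties using (≡-dec)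
open import Data.Sum using (inj₁; inj₂)
import Data.Vec as Vec
open import Data.Vec using ([]; _∷_; lookup; toList)
open import Data.Vec.Membership.Propositional.Properties using (∈-lookup; ∈-toList⁺)
open import Data.Vec.Properties using (tabulate∘lookup; tabulate-cong)
open import Function using (_∘_; _∘′_; case_of_)
open import Relation.Binary.Definitions using (DecidableEquality)
open import Relation.Binary.PropositionalEquality
open import Relation.Nullary using (¬_; Dec; yes; no; ¬?; _×-dec_; _→-dec_)
open import Relation.Unary using (Pred; Decidable)
open import Relation.Unary.Properties using (∁?)

module _ {A : Set} {ℓ} {P : Pred A ℓ} (P? : Decidable P) where

  length-filter+length-filter-∁ : ∀ xs → length (filter P? xs) + length (filter (∁? P?) xs) ≡ length xs
  length-filter+length-filter-∁ [] = refl
  length-filter+length-filter-∁ (x ∷ xs) with P? x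
  ... | yes _ = cong suc (length-filter+length-filter-∁ xs)
  ... | no _  = trans (+-suc _ _) (cong suc (length-filter+length-filter-∁ xs))

module _ {A : Set} where

  sum-map-mono : ∀ {f g : A → ℕ} xs → (∀ {x} → x ∈ xs → f x ≤ g x) → sum (map f xs) ≤ sum (map g xs)
  sum-map-mono [] f≤g = z≤n
  sum-map-mono (x ∷ xs) f≤g = +-mono-≤ (f≤g (here refl)) (sum-map-mono xs (f≤g ∘′ there))

  sum-map*≤length* : ∀ {f : A → ℕ} {c b} xs → (∀ {x} → x ∈ xs → f x * c ≤ b) →
                     sum (map f xs) * c ≤ length xs * b
  sum-map*≤length* [] bound = z≤n
  sum-map*≤length* {f} {c} {b} (x ∷ xs) bound = begin
    (f x + sum (map f xs)) * c     ≡⟨ *-distribʳ-+ c (f x) _ ⟩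
    f x * c + sum (map f xs) * c   ≤⟨ +-mono-≤ (bound (here refl)) (sum-map*≤length* xs (bound ∘′ there)) ⟩
    b + length xs * b              ∎
    where open ≤-Reasoning

  Unique∧allEqual⇒length≤1 : ∀ {xs : List A} → Unique xs → (∀ {x y} → x ∈ xs → y ∈ xs → x ≡ y) →
                             length xs ≤ 1
  Unique∧allEqual⇒length≤1 {[]} _ _ = z≤n
  Unique∧allEqual⇒length≤1 {_ ∷ []} _ _ = s≤s z≤n
  Unique∧allEqual⇒length≤1 {_ ∷ _ ∷ _} ((x≢y ∷ _) ∷ _) equal =
    ⊥-elim (x≢y (equal (here refl) (there (here refl))))

  Unique-map⁺ : ∀ {B : Set} {ℓ} {P : Pred A ℓ} {f : A → B} {xs} →
                (∀ {x y} → P x → P y → f x ≡ f y → x ≡ y) → All P xs → Unique xs → Unique (map f xs)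
  Unique-map⁺ injective [] [] = []
  Unique-map⁺ injective (px ∷ pxs) (x≢ ∷ unique) =
    All.map⁺ (All.zipWith (λ (x≢y , py) fx≡fy → x≢y (injective px py fx≡fy)) (x≢ , pxs))
    ∷ Unique-map⁺ injective pxs unique

  map-filter : ∀ {B : Set} {ℓ} {P : Pred B ℓ} (P? : Decidable P) (f : A → B) xs →
               map f (filter (P? ∘ f) xs) ≡ filter P? (map f xs)
  map-filter P? f [] = refl
  map-filter P? f (x ∷ xs) with P? (f x)
  ... | yes _ = cong (f x ∷_) (map-filter P? f xs)
  ... | no _  = map-filter P? f xs

module _ {A I : Set} {ℓ} {P : I → Pred A ℓ} (P? : ∀ i → Decidable (P i)) where

  length≤sum-length-filter : ∀ is xs → All (λ x → Any (λ i → P i x) is) xs →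
                             length xs ≤ sum (map (λ i → length (filter (P? i) xs)) is)
  length≤sum-length-filter [] [] _ = z≤n
  length≤sum-length-filter [] (x ∷ xs) (() ∷ _)
  length≤sum-length-filter (i ∷ is) xs covered = begin
    length xs
      ≡⟨ length-filter+length-filter-∁ (P? i) xs ⟨
    length (filter (P? i) xs) + length rest
      ≤⟨ +-monoʳ-≤ _ (length≤sum-length-filter is rest rest-covered) ⟩
    length (filter (P? i) xs) + sum (map (λ j → length (filter (P? j) rest)) is)
      ≤⟨ +-monoʳ-≤ _ (sum-map-mono is λ _ → Sublist.length-mono-≤ (filter-rest⊆ _)) ⟩
    sum (map (λ j → length (filter (P? j) xs)) (i ∷ is)) ∎
    where
    open ≤-Reasoning
    rest = filter (∁? (P? i)) xs
    filter-rest⊆ : ∀ j → filter (P? j) rest ⊑ filter (P? j) xs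
    filter-rest⊆ j = Sublist.filter⁺ (P? j) (P? j) (λ { refl p → p }) (Sublist.filter-⊆ (∁? (P? i)) xs)
    rest-covered : All (λ x → Any (λ j → P j x) is) rest
    rest-covered = All.tabulate λ x∈ → let x∈xs , ¬Pi = ∈-filter⁻ (∁? (P? i)) x∈ in
      case All.lookup covered x∈xs of λ { (here Pi) → ⊥-elim (¬Pi Pi) ; (there any) → any }

module _ {A : Set} (_≟_ : DecidableEquality A) where

  remove : A → List A → List A
  remove a = filter (λ x → ¬? (x ≟ a))

  remove-∉ : ∀ {a} xs → a ∉ xs → remove a xs ≡ xs
  remove-∉ xs a∉xs =
    filter-all (λ x → ¬? (x ≟ _)) (All.tabulate λ x∈xs x≡a → a∉xs (subst (_∈ xs) x≡a x∈xs))

  ↭-remove : ∀ {a xs} → Unique xs → a ∈ xs → xs ↭ a ∷ remove a xs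
  ↭-remove {a} {_ ∷ xs} (a≢ ∷ _) (here refl) =
    ↭-reflexive (cong (a ∷_) (sym (trans (filter-reject (λ x → ¬? (x ≟ a)) λ a≢a → a≢a refl)
                                         (remove-∉ xs (All¬⇒¬Any a≢)))))
  ↭-remove {a} {y ∷ xs} (y≢ ∷ unique) (there a∈xs) =
    ↭-trans (prep y (↭-remove unique a∈xs))
      (↭-trans (swap y a ↭-refl)
        (↭-reflexive (cong (a ∷_) (sym (filter-accept (λ x → ¬? (x ≟ a)) (All.lookup y≢ a∈xs))))))

  module _ {a : A} {xs : List A} (unique : Unique xs) (a∈xs : a ∈ xs) where

    length-remove : suc (length (remove a xs)) ≡ length xs
    length-remove = sym (↭-length (↭-remove unique a∈xs))

    module _ {ℓ} {P : Pred A ℓ} (P? : Decidable P) where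

      length-filter-remove-∈ : P a → suc (length (filter P? (remove a xs))) ≡ length (filter P? xs)
      length-filter-remove-∈ Pa = sym (trans (↭-length (filter-↭ P? (↭-remove unique a∈xs)))
                                             (cong length (filter-accept P? Pa)))

      length-filter-remove-∉ : ¬ P a → length (filter P? (remove a xs)) ≡ length (filter P? xs)
      length-filter-remove-∉ ¬Pa = sym (trans (↭-length (filter-↭ P? (↭-remove unique a∈xs)))
                                              (cong length (filter-reject P? ¬Pa)))

  module _ {B : Set} where

    delete : A → List (A × B) → List (A × B)
    delete a = filter (λ p → ¬? (proj₁ p ≟ a))

    keys-delete : ∀ a zs → map proj₁ (delete a zs) ≡ remove a (map proj₁ zs)
    keys-delete a = map-filter (λ x → ¬? (x ≟ a)) proj₁

    delete-∉ : ∀ {a} zs → a ∉ map proj₁ zs → delete a zs ≡ zs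
    delete-∉ zs a∉ = filter-all (λ p → ¬? (proj₁ p ≟ _))
      (All.tabulate λ p∈zs p≡a → a∉ (subst (_∈ _) p≡a (∈-map⁺ proj₁ p∈zs)))

    delete-injective : ∀ {a b} {zs zs' : List (A × B)} →
                       Unique (map proj₁ zs) → map proj₁ zs ≡ map proj₁ zs' →
                       (a , b) ∈ zs → (a , b) ∈ zs' → delete a zs ≡ delete a zs' → zs ≡ zs'
    delete-injective {zs = []} {[]} _ _ _ _ _ = refl
    delete-injective {a} {b} {(u , x) ∷ zs} {(_ , x') ∷ zs'} (u∉ ∷ unique) keys≡ ab∈ ab∈' deleted≡
      with ∷-injective keys≡ | a ≟ u
    ... | refl , keys≡' | yes refl =
      cong₂ _∷_ (cong (a ,_) (trans (value-at-head u∉ ab∈) (sym (value-at-head u∉' ab∈'))))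
      (begin
        zs                  ≡⟨ delete-∉ zs (All¬⇒¬Any u∉) ⟨
        delete a zs         ≡⟨ filter-reject (λ p → ¬? (proj₁ p ≟ a)) (λ a≢a → a≢a refl) ⟨
        delete a ((a , x) ∷ zs)   ≡⟨ deleted≡ ⟩
        delete a ((a , x') ∷ zs') ≡⟨ filter-reject (λ p → ¬? (proj₁ p ≟ a)) (λ a≢a → a≢a refl) ⟩
        delete a zs'        ≡⟨ delete-∉ zs' (All¬⇒¬Any u∉') ⟩
        zs'                 ∎)
      where
      open ≡-Reasoning
      u∉' : All (a ≢_) (map proj₁ zs')
      u∉' = subst (All (a ≢_)) keys≡' u∉
      value-at-head : ∀ {y ys} → All (a ≢_) (map proj₁ ys) → (a , b) ∈ (a , y) ∷ ys → y ≡ b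
      value-at-head _ (here refl) = refl
      value-at-head a∉ (there ab∈ys) = ⊥-elim (All¬⇒¬Any a∉ (∈-map⁺ proj₁ ab∈ys))
    ... | refl , keys≡' | no a≢u = cong₂ _∷_ (∷-injectiveˡ deleted≡')
      (delete-injective unique keys≡' (in-tail ab∈) (in-tail ab∈') (∷-injectiveʳ deleted≡'))
      where
      u≢a : u ≢ a
      u≢a = a≢u ∘ sym
      deleted≡' : (u , x) ∷ delete a zs ≡ (u , x') ∷ delete a zs'
      deleted≡' = trans (sym (filter-accept (λ p → ¬? (proj₁ p ≟ a)) u≢a))
                    (trans deleted≡ (filter-accept (λ p → ¬? (proj₁ p ≟ a)) u≢a))
      in-tail : ∀ {y ys} → (a , b) ∈ (u , y) ∷ ys → (a , b) ∈ ys
      in-tail (here refl) = ⊥-elim (u≢a refl)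
      in-tail (there ab∈ys) = ab∈ys

lookup-injective : ∀ {A : Set} {m} {xs : Vec A m} → Unique (toList xs) →
                   ∀ {i j} → lookup xs i ≡ lookup xs j → i ≡ j
lookup-injective {xs = _ ∷ _}  _           {zero}  {zero}  _   = refl
lookup-injective {xs = _ ∷ xs} (x∉ ∷ _)    {zero}  {suc j} x≡  =
  ⊥-elim (All¬⇒¬Any x∉ (subst (_∈ toList xs) (sym x≡) (∈-toList⁺ (∈-lookup j xs))))
lookup-injective {xs = _ ∷ xs} (x∉ ∷ _)    {suc i} {zero}  ≡x  =
  ⊥-elim (All¬⇒¬Any x∉ (subst (_∈ toList xs) ≡x (∈-toList⁺ (∈-lookup i xs))))
lookup-injective {xs = _ ∷ _}  (_ ∷ unique) {suc i} {suc j} eq = cong suc (lookup-injective unique eq)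

length-filter-∈-tabulate-suc : ∀ {n b} (T : Subset n) →
  length (filter (_∈ₛ? (b ∷ T)) (tabulate Fin.suc)) ≡ length (filter (_∈ₛ? T) (allFin n))
length-filter-∈-tabulate-suc {n} {b} T = begin
  length (filter (_∈ₛ? (b ∷ T)) (tabulate Fin.suc))
    ≡⟨ cong (length ∘ filter _) (map-tabulate {n = n} (λ i → i) Fin.suc) ⟨
  length (filter (_∈ₛ? (b ∷ T)) (map Fin.suc (allFin n)))
    ≡⟨ cong length (map-filter (_∈ₛ? (b ∷ T)) (Fin.suc {n}) (allFin n)) ⟨
  length (map Fin.suc (filter ((_∈ₛ? (b ∷ T)) ∘ Fin.suc) (allFin n)))
    ≡⟨ length-map (Fin.suc {n}) (filter ((_∈ₛ? (b ∷ T)) ∘ Fin.suc) (allFin n)) ⟩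
  length (filter ((_∈ₛ? (b ∷ T)) ∘ Fin.suc) (allFin n))
    ≡⟨ cong length (filter-≐ _ (_∈ₛ? T) (drop-there , Vec.there) (allFin n)) ⟩
  length (filter (_∈ₛ? T) (allFin n)) ∎
  where open ≡-Reasoning

length-filter-∈-allFin : ∀ {n} (T : Subset n) → length (filter (_∈ₛ? T) (allFin n)) ≡ ∣ T ∣
length-filter-∈-allFin {zero}  []          = refl
length-filter-∈-allFin {suc n} (true ∷ T)  =
  cong suc (trans (length-filter-∈-tabulate-suc T) (length-filter-∈-allFin T))
length-filter-∈-allFin {suc n} (false ∷ T) = trans (length-filter-∈-tabulate-suc T) (length-filter-∈-allFin T)

subsetsOfSize : ∀ n → ℕ → List (Subset n)
subsetsOfSize zero    zero    = [] ∷ []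
subsetsOfSize zero    (suc k) = []
subsetsOfSize (suc n) zero    = map (false ∷_) (subsetsOfSize n zero)
subsetsOfSize (suc n) (suc k) = map (true ∷_) (subsetsOfSize n k) ++ map (false ∷_) (subsetsOfSize n (suc k))

length-subsetsOfSize : ∀ n k → length (subsetsOfSize n k) ≡ n C k
length-subsetsOfSize zero    zero    = refl
length-subsetsOfSize zero    (suc k) = refl
length-subsetsOfSize (suc n) zero    = trans (length-map _ (subsetsOfSize n zero)) (length-subsetsOfSize n zero)
length-subsetsOfSize (suc n) (suc k) = begin
  length (map (true ∷_) (subsetsOfSize n k) ++ map (false ∷_) (subsetsOfSize n (suc k)))
    ≡⟨ length-++ (map (true ∷_) (subsetsOfSize n k)) ⟩
  length (map (true ∷_) (subsetsOfSize n k)) + length (map (false ∷_) (subsetsOfSize n (suc k)))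
    ≡⟨ cong₂ _+_ (length-map _ (subsetsOfSize n k)) (length-map _ (subsetsOfSize n (suc k))) ⟩
  length (subsetsOfSize n k) + length (subsetsOfSize n (suc k))
    ≡⟨ cong₂ _+_ (length-subsetsOfSize n k) (length-subsetsOfSize n (suc k)) ⟩
  n C k + n C suc k
    ≡⟨ nCk+nC[k+1]≡[n+1]C[k+1] n k ⟩
  suc n C suc k ∎
  where open ≡-Reasoning

∈-subsetsOfSize : ∀ {n} (T : Subset n) → T ∈ subsetsOfSize n ∣ T ∣
∈-subsetsOfSize [] = here refl
∈-subsetsOfSize {suc n} (true ∷ T) = ∈-++⁺ˡ (∈-map⁺ (true ∷_) (∈-subsetsOfSize T))
∈-subsetsOfSize {suc n} (false ∷ T) with ∣ T ∣ | ∈-subsetsOfSize T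
... | zero  | T∈ = ∈-map⁺ (false ∷_) T∈
... | suc k | T∈ = ∈-++⁺ʳ (map (true ∷_) (subsetsOfSize n k)) (∈-map⁺ (false ∷_) T∈)

subsetsOfSize-size : ∀ {n k} {T : Subset n} → T ∈ subsetsOfSize n k → ∣ T ∣ ≡ k
subsetsOfSize-size {zero}  {zero}  (here refl) = refl
subsetsOfSize-size {suc n} {zero}  T∈ with ∈-map⁻ (false ∷_) T∈
... | _ , T'∈ , refl = subsetsOfSize-size T'∈
subsetsOfSize-size {suc n} {suc k} T∈ with ∈-++⁻ (map (true ∷_) (subsetsOfSize n k)) T∈
... | inj₁ T∈₁ with ∈-map⁻ (true ∷_) T∈₁
...   | _ , T'∈ , refl = cong suc (subsetsOfSize-size T'∈)
subsetsOfSize-size {suc n} {suc k} T∈ | inj₂ T∈₂ with ∈-map⁻ (false ∷_) T∈₂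
...   | _ , T'∈ , refl = subsetsOfSize-size T'∈

subset-of-size : ∀ {n} (S : Subset n) {k} → k ≤ ∣ S ∣ → ∃[ T ] (T ⊆ₛ S × ∣ T ∣ ≡ k)
subset-of-size [] z≤n = [] , (λ ()) , refl
subset-of-size (false ∷ S) k≤ with subset-of-size S k≤
... | T , T⊆S , size = false ∷ T , (λ { (Vec.there x∈) → Vec.there (T⊆S x∈) }) , size
subset-of-size (true ∷ S) {zero} _ with subset-of-size S z≤n
... | T , T⊆S , size = false ∷ T , (λ { (Vec.there x∈) → Vec.there (T⊆S x∈) }) , size
subset-of-size (true ∷ S) {suc k} (s≤s k≤) with subset-of-size S k≤
... | T , T⊆S , size =
  true ∷ T , (λ { Vec.here → Vec.here ; (Vec.there x∈) → Vec.there (T⊆S x∈) }) , cong suc size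

-- m (m - 1) ⋯ (m - a + 1), the number of injections from an a-set into {0, …, m - 1}, written as
-- the recursion that splits them according to whether m - 1 is hit.
injections : ℕ → ℕ → ℕ
injections zero    zero    = 1
injections zero    (suc a) = 0
injections (suc m) a       = injections m a + a * injections m (pred a)

injections-< : ∀ {m a} → m < a → injections m a ≡ 0
injections-< {zero}  {suc a} _ = refl
injections-< {suc m} {suc a} (s≤s m<a)
  rewrite injections-< (m<n⇒m<1+n m<a) | injections-< m<a = *-zeroʳ (suc a)

injections-diagonal : ∀ m → injections m m ≡ m !
injections-diagonal zero = refl
injections-diagonal (suc m) rewrite injections-< (n<1+n m) | injections-diagonal m = refl

module Rankings {n} (G : Tournament n) (T : Subset n) where

  Assignment : Set
  Assignment = List (Fin n × ℕ)

  -- Orderings of Fin n are the case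
  -- m = n, V = allFin n; the generality is what lets the top rank be peeled off inductively.
  record IsRanking (m : ℕ) (V : List (Fin n)) (z : Assignment) : Set where
    field
      keys≡          : map proj₁ z ≡ V
      ranks<         : All (λ p → proj₂ p < m) z
      rank-injective : ∀ {p q} → p ∈ z → q ∈ z → proj₂ p ≡ proj₂ q → proj₁ p ≡ proj₁ q
      descending     : ∀ {u x w y} → (u , x) ∈ z → (w , y) ∈ z → u ∈ₛ T → w ∈ₛ T →
                       beats G u w ≡ true → y < x
  open IsRanking

  key-∈ : ∀ {m V z u x} → IsRanking m V z → (u , x) ∈ z → u ∈ V
  key-∈ r ux∈z = subst (_ ∈_) (keys≡ r) (∈-map⁺ proj₁ ux∈z)

  inside outside : List (Fin n) → List (Fin n)
  inside  = filter (_∈ₛ? T)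
  outside = filter (∁? (_∈ₛ? T))

  RankingBound : ℕ → Set
  RankingBound m = ∀ {V} → Unique V → ∀ {L} → Unique L → All (IsRanking m V) L →
                   length L * length (inside V) ! ≤ injections m (length V)

  ranking-zero-empty : ∀ {V z} → IsRanking 0 V z → z ≡ []
  ranking-zero-empty {z = []} _ = refl
  ranking-zero-empty {z = _ ∷ _} r with All.head (ranks< r)
  ... | ()

  rankingBound-zero : RankingBound 0
  rankingBound-zero _ {[]} _ _ = z≤n
  rankingBound-zero _ {L@(_ ∷ _)} unique rankings
    with ranking-zero-empty (All.head rankings) | keys≡ (All.head rankings)
  ... | refl | refl =
    *-monoˡ-≤ 1 (Unique∧allEqual⇒length≤1 unique λ z∈ z'∈ → trans (empty z∈) (sym (empty z'∈)))
    where
    empty : ∀ {z} → z ∈ L → z ≡ []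
    empty z∈ = ranking-zero-empty (All.lookup rankings z∈)

  Low : ℕ → Pred Assignment _
  Low m = All (λ p → proj₂ p < m)

  lower : ∀ {m V z} → IsRanking (suc m) V z → Low m z → IsRanking m V z
  lower r ranks<m = record { IsRanking r; ranks< = ranks<m }

  top-rank : ∀ {m V z} → IsRanking (suc m) V z → ¬ Low m z → ∃[ v ] ((v , m) ∈ z)
  top-rank {m} {z = z} r not-low with find (¬All⇒Any¬ (λ p → proj₂ p <? m) z not-low)
  ... | (v , x) , vx∈z , x≮m =
    v , subst (λ y → (v , y) ∈ z) (≤-antisym (s≤s⁻¹ (All.lookup (ranks< r) vx∈z)) (≮⇒≥ x≮m)) vx∈z

  ranking-delete : ∀ {m V z v} → IsRanking (suc m) V z → (v , m) ∈ z →
                   IsRanking m (remove _≟ᶠ_ v V) (delete _≟ᶠ_ v z)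
  ranking-delete {m} {V} {z} {v} r vm∈z = record
    { keys≡          = trans (keys-delete _≟ᶠ_ v z) (cong (remove _≟ᶠ_ v) (keys≡ r))
    ; ranks<         = All.tabulate ranks<m
    ; rank-injective = λ p∈ q∈ → rank-injective r (kept p∈) (kept q∈)
    ; descending     = λ p∈ q∈ → descending r (kept p∈) (kept q∈)
    }
    where
    kept : ∀ {p} → p ∈ delete _≟ᶠ_ v z → p ∈ z
    kept p∈ = proj₁ (∈-filter⁻ (λ p → ¬? (proj₁ p ≟ᶠ v)) p∈)
    ranks<m : ∀ {p} → p ∈ delete _≟ᶠ_ v z → proj₂ p < m
    ranks<m p∈ with ∈-filter⁻ (λ p → ¬? (proj₁ p ≟ᶠ v)) p∈
    ... | p∈z , p≢v = ≤∧≢⇒< (s≤s⁻¹ (All.lookup (ranks< r) p∈z)) (p≢v ∘ rank-injective r p∈z vm∈z)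

  IsKing : List (Fin n) → Fin n → Set
  IsKing V v = v ∈ₛ T × All (λ w → w ∈ₛ T → w ≢ v → beats G v w ≡ true) V

  isKing? : ∀ V → Decidable (IsKing V)
  isKing? V v =
    (v ∈ₛ? T) ×-dec All.all? (λ w → (w ∈ₛ? T) →-dec (¬? (w ≟ᶠ v) →-dec (beats G v w Bool.≟ true))) V

  kings : List (Fin n) → List (Fin n)
  kings V = filter (isKing? V) V

  king-unique : ∀ {V v w} → v ∈ V → w ∈ V → IsKing V v → IsKing V w → v ≡ w
  king-unique {v = v} {w} v∈V w∈V (v∈T , v-king) (w∈T , w-king) with v ≟ᶠ w
  ... | yes v≡w = v≡w
  ... | no v≢w with trans (sym (All.lookup v-king w∈V w∈T (v≢w ∘ sym))) (trans (orient G v w v≢w)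
                          (cong not (All.lookup w-king v∈V v∈T v≢w)))
  ...   | ()

  kings≤1 : ∀ {V} → Unique V → length (kings V) ≤ 1
  kings≤1 {V} unique = Unique∧allEqual⇒length≤1 (Unique.filter⁺ (isKing? V) unique) λ v∈ w∈ →
    let v∈V , v-king = ∈-filter⁻ (isKing? V) v∈
        w∈V , w-king = ∈-filter⁻ (isKing? V) w∈
    in king-unique v∈V w∈V v-king w-king

  top-outside-or-king : ∀ {m V z v} → IsRanking (suc m) V z → (v , m) ∈ z → v ∈ outside V ++ kings V
  top-outside-or-king {m} {V} {z} {v} r vm∈z with v ∈ₛ? T
  ... | no v∉T  = ∈-++⁺ˡ (∈-filter⁺ (∁? (_∈ₛ? T)) (key-∈ r vm∈z) v∉T)
  ... | yes v∈T = ∈-++⁺ʳ (outside V) (∈-filter⁺ (isKing? V) (key-∈ r vm∈z) (v∈T , All.tabulate beats-others))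
    where
    beats-others : ∀ {w} → w ∈ V → w ∈ₛ T → w ≢ v → beats G v w ≡ true
    beats-others {w} w∈V w∈T w≢v with ∈-map⁻ proj₁ (subst (w ∈_) (sym (keys≡ r)) w∈V) | beats G w v in w→v
    ... | (_ , y) , wy∈z , refl | true  =
      ⊥-elim (<⇒≱ (descending r wy∈z vm∈z w∈T v∈T w→v) (s≤s⁻¹ (All.lookup (ranks< r) wy∈z)))
    ... | _                     | false = trans (orient G v w (w≢v ∘ sym)) (cong not w→v)

  _≟ₚ_ : DecidableEquality (Fin n × ℕ)
  _≟ₚ_ = ≡-dec _≟ᶠ_ _≟ℕ_

  module Step {m} (IH : RankingBound m) {V} (uniqueV : Unique V)
              {L} (uniqueL : Unique L) (rankings : All (IsRanking (suc m) V) L) where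

    low? : Decidable (Low m)
    low? = All.all? (λ p → proj₂ p <? m)

    low high : List Assignment
    low  = filter low? L
    high = filter (∁? low?) L

    top? : ∀ v → Decidable {A = Assignment} ((v , m) ∈_)
    top? v z = DecMembership._∈?_ _≟ₚ_ (v , m) z

    topped : Fin n → List Assignment
    topped v = filter (top? v) high

    I′ k : ℕ
    I′ = injections m (pred (length V))
    k  = length (inside V)

    low-bound : length low * k ! ≤ injections m (length V)
    low-bound = IH uniqueV (Unique.filter⁺ low? uniqueL) (All.tabulate λ z∈ →
      let z∈L , all-low = ∈-filter⁻ low? z∈ in lower (All.lookup rankings z∈L) all-low)

    topped-bound : ∀ {v} → v ∈ V → length (topped v) * length (inside (remove _≟ᶠ_ v V)) ! ≤ I′
    topped-bound {v} v∈V = begin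
      length (topped v) * k′ !            ≡⟨ cong (_* k′ !) (length-map (delete _≟ᶠ_ v) (topped v)) ⟨
      length deleted * k′ !               ≤⟨ IH (Unique.filter⁺ _ uniqueV) deleted-unique deleted-rankings ⟩
      injections m (length V′)            ≡⟨ cong (injections m ∘ pred) (length-remove _≟ᶠ_ uniqueV v∈V) ⟩
      I′                                  ∎
      where
      open ≤-Reasoning
      V′ = remove _≟ᶠ_ v V
      k′ = length (inside V′)
      deleted = map (delete _≟ᶠ_ v) (topped v)
      tops : All (λ z → IsRanking (suc m) V z × (v , m) ∈ z) (topped v)
      tops = All.tabulate λ z∈ → let z∈high , vm∈ = ∈-filter⁻ (top? v) z∈ in
        All.lookup rankings (proj₁ (∈-filter⁻ (∁? low?) z∈high)) , vm∈
      deleted-unique : Unique deleted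
      deleted-unique = Unique-map⁺ (λ (r , vm∈) (r′ , vm∈′) → delete-injective _≟ᶠ_
          (subst Unique (sym (keys≡ r)) uniqueV) (trans (keys≡ r) (sym (keys≡ r′))) vm∈ vm∈′)
        tops (Unique.filter⁺ _ (Unique.filter⁺ _ uniqueL))
      deleted-rankings : All (IsRanking m V′) deleted
      deleted-rankings = All.map⁺ (All.map (λ (r , vm∈) → ranking-delete r vm∈) tops)

    outside-bound : ∀ {v} → v ∈ outside V → length (topped v) * k ! ≤ I′
    outside-bound {v} v∈ with ∈-filter⁻ (∁? (_∈ₛ? T)) v∈
    ... | v∈V , v∉T = subst (λ i → length (topped v) * i ! ≤ I′)
      (length-filter-remove-∉ _≟ᶠ_ uniqueV v∈V (_∈ₛ? T) v∉T) (topped-bound v∈V)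

    king-bound : ∀ {v} → v ∈ kings V → length (topped v) * k ! ≤ k * I′
    king-bound {v} v∈ with ∈-filter⁻ (isKing? V) v∈
    ... | v∈V , v∈T , _ rewrite sym (length-filter-remove-∈ _≟ᶠ_ uniqueV v∈V (_∈ₛ? T) v∈T) = begin
      t * (suc k' * k' !)  ≡⟨ x∙yz≈y∙xz t (suc k') (k' !) ⟩
      suc k' * (t * k' !)  ≤⟨ *-monoʳ-≤ (suc k') (topped-bound v∈V) ⟩
      suc k' * I′          ∎
      where
      open ≤-Reasoning
      t  = length (topped v)
      k' = length (inside (remove _≟ᶠ_ v V))

    high-covered : All (λ z → Any (λ v → (v , m) ∈ z) (outside V ++ kings V)) high
    high-covered = All.tabulate λ z∈ → let z∈L , not-low = ∈-filter⁻ (∁? low?) z∈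
                                           r = All.lookup rankings z∈L
                                           v , vm∈z = top-rank r not-low
                                       in lose (top-outside-or-king r vm∈z) vm∈z

    high-bound : length high * k ! ≤ length V * I′
    high-bound = begin
      length high * k !
        ≤⟨ *-monoˡ-≤ (k !) (length≤sum-length-filter top? (outside V ++ kings V) high high-covered) ⟩
      sum (map tops (outside V ++ kings V)) * k !
        ≡⟨ cong (λ s → sum s * k !) (map-++ tops (outside V) (kings V)) ⟩
      sum (map tops (outside V) ++ map tops (kings V)) * k !
        ≡⟨ cong (_* k !) (sum-++ (map tops (outside V)) _) ⟩
      (sum (map tops (outside V)) + sum (map tops (kings V))) * k !
        ≡⟨ *-distribʳ-+ (k !) (sum (map tops (outside V))) _ ⟩
      sum (map tops (outside V)) * k ! + sum (map tops (kings V)) * k !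
        ≤⟨ +-mono-≤ (sum-map*≤length* (outside V) outside-bound) (sum-map*≤length* (kings V) king-bound) ⟩
      length (outside V) * I′ + length (kings V) * (k * I′)
        ≤⟨ +-monoʳ-≤ _ (*-monoˡ-≤ (k * I′) (kings≤1 uniqueV)) ⟩
      length (outside V) * I′ + (k * I′ + 0)
        ≡⟨ cong (length (outside V) * I′ +_) (+-identityʳ (k * I′)) ⟩
      length (outside V) * I′ + k * I′
        ≡⟨ *-distribʳ-+ I′ (length (outside V)) k ⟨
      (length (outside V) + k) * I′
        ≡⟨ cong (_* I′) (trans (+-comm _ k) (length-filter+length-filter-∁ (_∈ₛ? T) V)) ⟩
      length V * I′ ∎
      where
      open ≤-Reasoning
      tops : Fin n → ℕ
      tops v = length (topped v)

  rankingBound-suc : ∀ {m} → RankingBound m → RankingBound (suc m)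
  rankingBound-suc {m} IH {V} uniqueV {L} uniqueL rankings = begin
    length L * k !                            ≡⟨ cong (_* k !) (length-filter+length-filter-∁ low? L) ⟨
    (length low + length high) * k !          ≡⟨ *-distribʳ-+ (k !) (length low) _ ⟩
    length low * k ! + length high * k !      ≤⟨ +-mono-≤ low-bound high-bound ⟩
    injections (suc m) (length V)             ∎
    where
    open ≤-Reasoning
    open Step IH uniqueV uniqueL rankings

  rankingBound : ∀ m → RankingBound m
  rankingBound zero    = rankingBound-zero
  rankingBound (suc m) = rankingBound-suc (rankingBound m)

module Orderings {n} (G : Tournament n) where

  rank : Vec (Fin n) n → Fin n → ℕ
  rank r u = toℕ (lookup r u)

  rankingOf : Vec (Fin n) n → List (Fin n × ℕ)
  rankingOf r = map (λ u → u , rank r u) (allFin n)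

  ∈-rankingOf : ∀ r {p} → p ∈ rankingOf r → ∃[ u ] (p ≡ (u , rank r u))
  ∈-rankingOf r p∈ with ∈-map⁻ _ p∈
  ... | u , _ , p≡ = u , p≡

  rankingOf-injective : ∀ {r r'} → rankingOf r ≡ rankingOf r' → r ≡ r'
  rankingOf-injective {r} {r'} eq =
    trans (sym (tabulate∘lookup r)) (trans (tabulate-cong same-rank) (tabulate∘lookup r'))
    where
    same-rank : ∀ u → lookup r u ≡ lookup r' u
    same-rank u with ∈-rankingOf r' (subst ((u , rank r u) ∈_) eq (∈-map⁺ (λ u → u , rank r u) (∈-allFin u)))
    ... | _ , uu≡ with cong proj₁ uu≡
    ...   | refl = toℕ-injective (cong proj₂ uu≡)

  rankingOf-isRanking : ∀ {T r} → IsOrdering r → Independent G r T →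
                        Rankings.IsRanking G T n (allFin n) (rankingOf r)
  rankingOf-isRanking {T} {r} ordering independent = record
    { keys≡          = trans (sym (map-∘ (allFin n))) (map-id (allFin n))
    ; ranks<         = All.tabulate λ p∈ → case ∈-rankingOf r p∈ of λ { (u , refl) → toℕ<n (lookup r u) }
    ; rank-injective = λ p∈ q∈ → case ∈-rankingOf r p∈ , ∈-rankingOf r q∈ of λ
        { ((_ , refl) , (_ , refl)) → lookup-injective ordering ∘ toℕ-injective }
    ; descending     = λ p∈ q∈ → case ∈-rankingOf r p∈ , ∈-rankingOf r q∈ of λ
        { ((u , refl) , (w , refl)) u∈T w∈T u→w → ≤∧≢⇒<
            (≮⇒≥ λ forward → independent u w u∈T w∈T (u→w , forward))
            (λ same-rank → case lookup-injective ordering (toℕ-injective same-rank) of λ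
              { refl → case trans (sym u→w) (irrefl G w) of λ () }) }
    }

  orderings-bound : ∀ (T : Subset n) {L : List (Vec (Fin n) n)} → Unique L →
                    All (λ r → IsOrdering r × Independent G r T) L → length L * ∣ T ∣ ! ≤ n !
  orderings-bound T {L} unique orderings = begin
    length L * ∣ T ∣ !
      ≡⟨ cong₂ (λ ℓ t → ℓ * t !) (length-map rankingOf L) (length-filter-∈-allFin T) ⟨
    length (map rankingOf L) * length (filter (_∈ₛ? T) (allFin n)) !
      ≤⟨ Rankings.rankingBound G T n (Unique.allFin⁺ n) (Unique.map⁺ rankingOf-injective unique)
           (All.map⁺ (All.map (λ (ordering , independent) → rankingOf-isRanking ordering independent) orderings)) ⟩
    injections n (length (allFin n))
      ≡⟨ cong (injections n) (length-tabulate (λ u → u)) ⟩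
    injections n n
      ≡⟨ injections-diagonal n ⟩
    n ! ∎
    where open ≤-Reasoning

  independent? : ∀ T r → Dec (Independent G r T)
  independent? T r = all? λ u → all? λ w → (u ∈ₛ? T) →-dec ((w ∈ₛ? T) →-dec
                       ¬? ((beats G u w Bool.≟ true) ×-dec (lookup r u <ᶠ? lookup r w)))

  orderings-with-independent-set-bound : ∀ k {L} → Unique L →
    All (λ r → IsOrdering r × ∃[ S ] (Independent G r S × k ≤ ∣ S ∣)) L → length L * k ! ≤ (n C k) * n !
  orderings-with-independent-set-bound k {L} unique orderings = begin
    length L * k !
      ≤⟨ *-monoˡ-≤ (k !) (length≤sum-length-filter independent? (subsetsOfSize n k) L covered) ⟩
    sum (map (λ T → length (filter (independent? T) L)) (subsetsOfSize n k)) * k !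
      ≤⟨ sum-map*≤length* (subsetsOfSize n k) per-subset ⟩
    length (subsetsOfSize n k) * n !
      ≡⟨ cong (_* n !) (length-subsetsOfSize n k) ⟩
    (n C k) * n ! ∎
    where
    open ≤-Reasoning
    covered : All (λ r → Any (λ T → Independent G r T) (subsetsOfSize n k)) L
    covered = All.map (λ { (_ , S , independent , k≤) → case subset-of-size S k≤ of λ
      { (T , T⊆S , size) → lose (subst (λ c → T ∈ subsetsOfSize n c) size (∈-subsetsOfSize T))
                                 (λ u w u∈T w∈T → independent u w (T⊆S u∈T) (T⊆S w∈T)) } }) orderings
    per-subset : ∀ {T} → T ∈ subsetsOfSize n k → length (filter (independent? T) L) * k ! ≤ n !
    per-subset {T} T∈ = subst (λ c → length (filter (independent? T) L) * c ! ≤ n !) (subsetsOfSize-size T∈)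
      (orderings-bound T (Unique.filter⁺ (independent? T) unique) (All.tabulate λ r∈ →
        let r∈L , independent = ∈-filter⁻ (independent? T) r∈ in proj₁ (All.lookup orderings r∈L) , independent))

^-distribʳ-* : ∀ m n o → (m * n) ^ o ≡ m ^ o * n ^ o
^-distribʳ-* m n zero    = refl
^-distribʳ-* m n (suc o) = trans (cong (m * n *_) (^-distribʳ-* m n o)) (interchange m n (m ^ o) (n ^ o))

n^[1+k]+[1+k]n^k≤[1+n]^[1+k] : ∀ n k → n ^ suc k + suc k * n ^ k ≤ suc n ^ suc k
n^[1+k]+[1+k]n^k≤[1+n]^[1+k] n zero    = ≤-reflexive (+-comm (n * 1) 1)
n^[1+k]+[1+k]n^k≤[1+n]^[1+k] n (suc k) = begin
  n * (n * n ^ k) + (2 + k) * (n * n ^ k)                   ≤⟨ m≤m+n _ _ ⟩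
  n * (n * n ^ k) + (2 + k) * (n * n ^ k) + (1 + k) * n ^ k ≡⟨ expand n (n ^ k) k ⟨
  (1 + n) * (n * n ^ k + (1 + k) * n ^ k)                   ≤⟨ *-monoʳ-≤ (1 + n) (n^[1+k]+[1+k]n^k≤[1+n]^[1+k] n k) ⟩
  (1 + n) * suc n ^ suc k                                   ∎
  where
  open ≤-Reasoning
  expand : ∀ n b k → (1 + n) * (n * b + (1 + k) * b) ≡ n * (n * b) + (2 + k) * (n * b) + (1 + k) * b
  expand = solve-∀

nCk*k!≤n^k : ∀ n k → (n C k) * k ! ≤ n ^ k
nCk*k!≤n^k zero    zero    = ≤-refl
nCk*k!≤n^k zero    (suc k) = z≤n
nCk*k!≤n^k (suc n) zero    = ≤-refl
nCk*k!≤n^k (suc n) (suc k) = begin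
  (suc n C suc k) * (suc k * k !)
    ≡⟨ cong (_* (suc k * k !)) (nCk+nC[k+1]≡[n+1]C[k+1] n k) ⟨
  (n C k + n C suc k) * (suc k * k !)
    ≡⟨ distribute (n C k) (n C suc k) k (k !) ⟩
  suc k * ((n C k) * k !) + (n C suc k) * (suc k * k !)
    ≤⟨ +-mono-≤ (*-monoʳ-≤ (suc k) (nCk*k!≤n^k n k)) (nCk*k!≤n^k n (suc k)) ⟩
  suc k * n ^ k + n ^ suc k
    ≡⟨ +-comm (suc k * n ^ k) (n ^ suc k) ⟩
  n ^ suc k + suc k * n ^ k
    ≤⟨ n^[1+k]+[1+k]n^k≤[1+n]^[1+k] n k ⟩
  suc n ^ suc k ∎
  where
  open ≤-Reasoning
  distribute : ∀ a b k f → (a + b) * (suc k * f) ≡ suc k * (a * f) + b * (suc k * f)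
  distribute = solve-∀

m!*m^n≤[m+n]! : ∀ m n → m ! * m ^ n ≤ (m + n) !
m!*m^n≤[m+n]! m zero    = ≤-reflexive (trans (*-identityʳ (m !)) (cong _! (sym (+-identityʳ m))))
m!*m^n≤[m+n]! m (suc n) = begin
  m ! * (m * m ^ n)        ≡⟨ x∙yz≈y∙xz (m !) m (m ^ n) ⟩
  m * (m ! * m ^ n)        ≤⟨ *-mono-≤ (m≤n⇒m≤1+n (m≤m+n m n)) (m!*m^n≤[m+n]! m n) ⟩
  suc (m + n) * (m + n) !  ≡⟨ cong _! (+-suc m n) ⟨
  (m + suc n) !            ∎
  where open ≤-Reasoning

-- Along powers of two the bound doubles: (2k)^(2k) = 4^k (k^k)² and k! k^k ≤ (2k)!.
[2^i]^[2^i]≤4^[2^i]*[2^i]! : ∀ i → (2 ^ i) ^ (2 ^ i) ≤ 4 ^ (2 ^ i) * (2 ^ i) !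
[2^i]^[2^i]≤4^[2^i]*[2^i]! zero    = s≤s z≤n
[2^i]^[2^i]≤4^[2^i]*[2^i]! (suc i) = begin
  (2 * k) ^ (2 * k)                ≡⟨ ^-distribʳ-* 2 k (2 * k) ⟩
  2 ^ (2 * k) * k ^ (2 * k)        ≡⟨ cong₂ _*_ (^-*-assoc 2 2 k) (trans (sym (^-distribˡ-+-* k k k)) (cong (k ^_) (sym 2k≡k+k))) ⟨
  4 ^ k * (k ^ k * k ^ k)          ≤⟨ *-monoʳ-≤ (4 ^ k) (*-monoˡ-≤ (k ^ k) ([2^i]^[2^i]≤4^[2^i]*[2^i]! i)) ⟩
  4 ^ k * (4 ^ k * k ! * k ^ k)    ≡⟨ regroup (4 ^ k) (k !) (k ^ k) ⟩
  4 ^ k * 4 ^ k * (k ! * k ^ k)    ≤⟨ *-monoʳ-≤ (4 ^ k * 4 ^ k) (m!*m^n≤[m+n]! k k) ⟩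
  4 ^ k * 4 ^ k * (k + k) !        ≡⟨ cong (_* (k + k) !) (^-distribˡ-+-* 4 k k) ⟨
  4 ^ (k + k) * (k + k) !          ≡⟨ cong (λ e → 4 ^ e * e !) 2k≡k+k ⟨
  4 ^ (2 * k) * (2 * k) !          ∎
  where
  open ≤-Reasoning
  k = 2 ^ i
  2k≡k+k : 2 * k ≡ k + k
  2k≡k+k = cong (k +_) (+-identityʳ k)
  regroup : ∀ a f x → a * (a * f * x) ≡ a * a * (f * x)
  regroup = solve-∀

log₄-bracket : ∀ n → ∃[ j ] (4 ^ j ≤ suc n × suc n < 4 ^ suc j)
log₄-bracket zero = 0 , ≤-refl , s≤s (s≤s z≤n)
log₄-bracket (suc n) with log₄-bracket n
... | j , lower , upper with suc (suc n) <? 4 ^ suc j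
...   | yes upper' = j , m≤n⇒m≤1+n lower , upper'
...   | no ¬upper' =
  suc j , ≤-reflexive (sym n+2≡4^[j+1]) , subst (_< 4 ^ suc (suc j)) (sym n+2≡4^[j+1]) 4^[j+1]<4^[j+2]
  where
  4^[j+1]<4^[j+2] : 4 ^ suc j < 4 ^ suc (suc j)
  4^[j+1]<4^[j+2] =
    subst (4 ^ suc j <_) (*-comm (4 ^ suc j) 4) (m<m*n (4 ^ suc j) 4 {{m^n≢0 4 (suc j)}} (s≤s (s≤s z≤n)))
  n+2≡4^[j+1] : suc (suc n) ≡ 4 ^ suc j
  n+2≡4^[j+1] = ≤-antisym upper (≮⇒≥ ¬upper')

⌊log₄_⌋ : ℕ → ℕ
⌊log₄ zero  ⌋ = 0
⌊log₄ suc n ⌋ = proj₁ (log₄-bracket n)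

⌊log₄⌋-tendsToInfinity : TendsToInfinity ⌊log₄_⌋
⌊log₄⌋-tendsToInfinity M = 4 ^ M , large
  where
  large : ∀ n → 4 ^ M ≤ n → M ≤ ⌊log₄ n ⌋
  large zero    4^M≤0 = ⊥-elim (<⇒≱ (m^n>0 4 M) 4^M≤0)
  large (suc n) 4^M≤n with log₄-bracket n
  ... | j , _ , upper = ≮⇒≥ λ j<M → <⇒≱ upper (≤-trans (^-monoʳ-≤ 4 j<M) 4^M≤n)

n<2^n : ∀ n → n < 2 ^ n
n<2^n zero    = s≤s z≤n
n<2^n (suc n) = begin-strict
  suc n          ≡⟨ +-comm 1 n ⟩
  n + 1          <⟨ +-mono-<-≤ (n<2^n n) (m^n>0 2 n) ⟩
  2 ^ n + 2 ^ n  ≡⟨ cong (2 ^ n +_) (+-identityʳ (2 ^ n)) ⟨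
  2 * 2 ^ n      ∎
  where open ≤-Reasoning

n+n*n≤16*2^n : ∀ n → n + n * n ≤ 16 * 2 ^ n
n+n*n≤16*2^n zero    = z≤n
n+n*n≤16*2^n (suc n) = begin
  suc n + suc n * suc n       ≡⟨ expand n ⟩
  (n + n * n) + 2 * suc n     ≤⟨ +-mono-≤ (n+n*n≤16*2^n n) (*-monoʳ-≤ 2 (≤-trans (n<2^n n) (m≤n*m (2 ^ n) 8))) ⟩
  16 * 2 ^ n + 2 * (8 * 2 ^ n) ≡⟨ double (2 ^ n) ⟩
  16 * (2 * 2 ^ n)            ∎
  where
  open ≤-Reasoning
  expand : ∀ n → suc n + suc n * suc n ≡ (n + n * n) + 2 * suc n
  expand = solve-∀
  double : ∀ x → 16 * x + 2 * (8 * x) ≡ 16 * (2 * x)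
  double = solve-∀

[16*2^j]²≡256*4^j : ∀ j → (16 * 2 ^ j) * (16 * 2 ^ j) ≡ 256 * 4 ^ j
[16*2^j]²≡256*4^j j = trans (solve-square (2 ^ j)) (cong (256 *_) (sym (^-distribʳ-* 2 2 j)))
  where
  solve-square : ∀ x → (16 * x) * (16 * x) ≡ 256 * (x * x)
  solve-square = solve-∀

N^j*N^k≤k!*k! : ∀ {N} j → N < 4 ^ suc j → let k = 16 * 2 ^ j in N ^ j * N ^ k ≤ k ! * k !
N^j*N^k≤k!*k! {N} j N<4^[j+1] = *-cancelˡ-≤ (16 ^ k) {{m^n≢0 16 k}} (begin
  16 ^ k * (N ^ j * N ^ k)        ≤⟨ *-monoʳ-≤ (16 ^ k) (*-monoˡ-≤ (N ^ k) N^j≤4^k) ⟩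
  16 ^ k * (4 ^ k * N ^ k)        ≡⟨ *-assoc (16 ^ k) (4 ^ k) (N ^ k) ⟨
  16 ^ k * 4 ^ k * N ^ k          ≡⟨ cong (_* N ^ k) (^-distribʳ-* 16 4 k) ⟨
  64 ^ k * N ^ k                  ≡⟨ ^-distribʳ-* 64 N k ⟨
  (64 * N) ^ k                    ≤⟨ ^-monoˡ-≤ k 64N≤k² ⟩
  (k * k) ^ k                     ≡⟨ ^-distribʳ-* k k k ⟩
  k ^ k * k ^ k                   ≤⟨ *-mono-≤ k^k≤4^k*k! k^k≤4^k*k! ⟩
  4 ^ k * k ! * (4 ^ k * k !)     ≡⟨ interchange (4 ^ k) (k !) (4 ^ k) (k !) ⟩
  4 ^ k * 4 ^ k * (k ! * k !)     ≡⟨ cong (_* (k ! * k !)) (^-distribʳ-* 4 4 k) ⟨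
  16 ^ k * (k ! * k !)            ∎)
  where
  open ≤-Reasoning
  k = 16 * 2 ^ j
  k^k≤4^k*k! : k ^ k ≤ 4 ^ k * k !
  k^k≤4^k*k! = subst (λ t → t ^ t ≤ 4 ^ t * t !) (2^[4+j]≡16*2^j (2 ^ j)) ([2^i]^[2^i]≤4^[2^i]*[2^i]! (4 + j))
    where
    2^[4+j]≡16*2^j : ∀ x → 2 * (2 * (2 * (2 * x))) ≡ 16 * x
    2^[4+j]≡16*2^j = solve-∀
  N^j≤4^k : N ^ j ≤ 4 ^ k
  N^j≤4^k = begin
    N ^ j              ≤⟨ ^-monoˡ-≤ j (<⇒≤ N<4^[j+1]) ⟩
    (4 ^ suc j) ^ j    ≡⟨ ^-*-assoc 4 (suc j) j ⟩
    4 ^ (j + j * j)    ≤⟨ ^-monoʳ-≤ 4 (n+n*n≤16*2^n j) ⟩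
    4 ^ k              ∎
  64N≤k² : 64 * N ≤ k * k
  64N≤k² = begin
    64 * N             ≤⟨ *-monoʳ-≤ 64 (<⇒≤ N<4^[j+1]) ⟩
    64 * (4 * 4 ^ j)   ≡⟨ *-assoc 64 4 (4 ^ j) ⟨
    256 * 4 ^ j        ≡⟨ [16*2^j]²≡256*4^j j ⟨
    k * k              ∎

orderings-with-large-α-bound : ∀ n → 1 ≤ n → (G : Tournament n) → (L : List (Vec (Fin n) n)) → Unique L →
                               All (λ r → IsOrdering r × AlphaExceeds G r 16) L → length L * n ^ ⌊log₄ n ⌋ ≤ n !
orderings-with-large-α-bound N@(suc m) _ G L unique orderings with log₄-bracket m
... | j , 4^j≤N , N<4^[j+1] = *-cancelʳ-≤ (length L * N ^ j) (N !) (N ^ k) {{m^n≢0 N k}} (begin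
  length L * N ^ j * N ^ k    ≡⟨ *-assoc (length L) (N ^ j) (N ^ k) ⟩
  length L * (N ^ j * N ^ k)  ≤⟨ *-monoʳ-≤ (length L) (N^j*N^k≤k!*k! j N<4^[j+1]) ⟩
  length L * (k ! * k !)      ≡⟨ *-assoc (length L) (k !) (k !) ⟨
  length L * k ! * k !        ≤⟨ *-monoˡ-≤ (k !) (Orderings.orderings-with-independent-set-bound G k unique large) ⟩
  (N C k) * N ! * k !         ≡⟨ xy∙z≈xz∙y (N C k) (N !) (k !) ⟩
  (N C k) * k ! * N !         ≤⟨ *-monoˡ-≤ (N !) (nCk*k!≤n^k N k) ⟩
  N ^ k * N !                 ≡⟨ *-comm (N ^ k) (N !) ⟩
  N ! * N ^ k                 ∎)
  where
  open ≤-Reasoning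
  k = 16 * 2 ^ j
  k≤size : ∀ s → 16 * 16 * N < s * s → k ≤ s
  k≤size s 256N<s² = ≮⇒≥ λ s<k → <⇒≱ 256N<s² (begin
    s * s        ≤⟨ *-mono-≤ (<⇒≤ s<k) (<⇒≤ s<k) ⟩
    k * k        ≡⟨ [16*2^j]²≡256*4^j j ⟩
    256 * 4 ^ j  ≤⟨ *-monoʳ-≤ 256 4^j≤N ⟩
    256 * N      ∎)
  large : All (λ r → IsOrdering r × ∃[ S ] (Independent G r S × k ≤ ∣ S ∣)) L
  large = All.map (λ (ordering , S , independent , 256N<∣S∣²) → ordering , S , independent , k≤size ∣ S ∣ 256N<∣S∣²)
                  orderings

lemma2p7 : ∃[ C ] (0 < C × ∃[ f ] (TendsToInfinity f ×
             (∀ (n : ℕ) → 1 ≤ n → (G : Tournament n) →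
               (L : List (Vec (Fin n) n)) → Unique L →
               All (λ r → IsOrdering r × AlphaExceeds G r C) L →
               length L * n ^ f n ≤ n !)))
lemma2p7 = 16 , s≤s z≤n , ⌊log₄_⌋ , ⌊log₄⌋-tendsToInfinity , orderings-with-large-α-bound
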